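{- For all integers $n\ge2$ and $0\le h\le n-2$, $$|\{A\in\mathcal B_n:\mathrm{lch}(A)>h\}|=|\mathcal B_{n-h}|=|\{A\in\mathcal B_n:\mathrm{lhs}(A)>h\}|.$$ In particular, the statistics $\mathrm{lch}$ and $\mathrm{lhs}$ have the same distribution on $\mathcal B_n$ for every $n$.
   Context: A bargraph is a lattice path with steps $U=(0,1)$, $H=(1,0)$, $D=(0,-1)$, identified with its word over $\{U,H,D\}$, that starts at the origin, ends on the $x$-axis, stays strictly above the $x$-axis except at its endpoints, and contains no two consecutive steps $UD$ or $DU$ (the empty path is not a bargraph). Its semiperimeter is its number of $U$ steps plus its number of $H$ steps, and $\mathcal B_n$ is the set of bargraphs of semiperimeter $n$. $\mathrm{lch}(A)$ is the minimum height ($y$-coordinate) of an $H$ step of $A$; $\mathrm{lhs}(A)$ is the length of the first maximal run of consecutive $H$ steps of $A$. -}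

module Defs where

open import Data.Bool using (Bool; true; false; _∧_; if_then_else_)
open import Data.Nat using (ℕ; zero; suc; _+_; _*_; _≡ᵇ_)
open import Data.Integer as ℤ using (ℤ; +_; _⊓_; _≤ᵇ_) renaming (_+_ to _+ℤ_)
open import Data.List using (List; []; _∷_; map; concatMap; length; filterᵇ; _++_)

-- Steps of a lattice path: U = (0,1), H = (1,0), D = (0,-1).
data Step : Set where
  U H D : Step

Word : Set
Word = List Step

δ : Step → ℤ
δ U = + 1
δ H = + 0
δ D = ℤ.- (+ 1)

infix 4 _==ℤ_
_==ℤ_ : ℤ → ℤ → Bool
x ==ℤ y = (x ≤ᵇ y) ∧ (y ≤ᵇ x)

height : Word → ℤ
height [] = + 0
height (s ∷ w) = δ s +ℤ height w

visited : ℤ → Word → List ℤ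
visited y [] = []
visited y (s ∷ w) = (y +ℤ δ s) ∷ visited (y +ℤ δ s) w

allᵇ : {A : Set} → (A → Bool) → List A → Bool
allᵇ p [] = true
allᵇ p (x ∷ xs) = p x ∧ allᵇ p xs

init : {A : Set} → List A → List A
init [] = []
init (x ∷ []) = []
init (x ∷ y ∷ xs) = x ∷ init (y ∷ xs)

hHeights : ℤ → Word → List ℤ
hHeights y [] = []
hHeights y (H ∷ w) = y ∷ hHeights y w
hHeights y (s ∷ w) = hHeights (y +ℤ δ s) w

noUDorDU : Word → Bool
noUDorDU (U ∷ D ∷ w) = false
noUDorDU (D ∷ U ∷ w) = false
noUDorDU (s ∷ w) = noUDorDU w
noUDorDU [] = true

nonEmpty : Word → Bool
nonEmpty [] = false
nonEmpty (_ ∷ _) = true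

-- A (read from the origin) is a bargraph: nonempty, ends on the x-axis,
-- every lattice point other than the two endpoints has height ≥ 1,
-- every H step lies at height ≥ 1 (so the path is strictly above the x-axis
-- except at its endpoints; this excludes the one-step word H),
-- and no two consecutive steps UD or DU.
isBargraph : Word → Bool
isBargraph w =
  nonEmpty w ∧ (height w ==ℤ + 0)
  ∧ allᵇ (λ y → + 1 ≤ᵇ y) (init (visited (+ 0) w))
  ∧ allᵇ (λ y → + 1 ≤ᵇ y) (hHeights (+ 0) w)
  ∧ noUDorDU w

_==s_ : Step → Step → Bool
U ==s U = true
H ==s H = true
D ==s D = true
_ ==s _ = false

count : Step → Word → ℕ
count s [] = 0
count s (t ∷ w) = if s ==s t then suc (count s w) else count s w

semiperimeter : Word → ℕ
semiperimeter w = count U w + count H w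

wordsOfLength : ℕ → List Word
wordsOfLength zero = [] ∷ []
wordsOfLength (suc k) = concatMap (λ w → (U ∷ w) ∷ (H ∷ w) ∷ (D ∷ w) ∷ []) (wordsOfLength k)

wordsUpTo : ℕ → List Word
wordsUpTo zero = wordsOfLength zero
wordsUpTo (suc k) = wordsOfLength (suc k) ++ wordsUpTo k

-- A bargraph has #D = #U, so its length is #U+#H+#D ≤ 2n; hence
-- enumerating all words of length ≤ 2n finds every bargraph of semiperimeter n.
𝓑 : ℕ → List Word
𝓑 n = filterᵇ (λ w → isBargraph w ∧ (semiperimeter w ≡ᵇ n)) (wordsUpTo (2 * n))

minimum : ℤ → List ℤ → ℤ
minimum x [] = x
minimum x (y ∷ ys) = minimum (x ⊓ y) ys

-- lch(A) : minimum height of an H step of A (every bargraph has an H step,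
-- since UD is forbidden; the default + 0 for words without H is never used on bargraphs)
lch : Word → ℤ
lch w with hHeights (+ 0) w
... | [] = + 0
... | y ∷ ys = minimum y ys

hRun : Word → ℕ
hRun (H ∷ w) = suc (hRun w)
hRun _ = 0

lhs : Word → ℕ
lhs [] = 0
lhs (H ∷ w) = hRun (H ∷ w)
lhs (_ ∷ w) = lhs w

-- Both statistics have the tail counts #{A ∈ 𝓑 n : stat A > h} = |𝓑 (n ∸ h)|, so they are
-- equidistributed: the number with stat = k+1 is the difference of the tail counts at k and k+1.
-- For lch, A ↦ U A D raises a bargraph by one, adding one to semiperimeter and to lch; it is a
-- bijection onto the bargraphs with lch > 1, since removing the first and last step of such a
-- bargraph leaves a path that can touch the axis only at its ends. For lhs, doubling the first
-- H step widens the first column, a bijection onto the bargraphs with lhs > 1. Both tail counts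
-- are therefore invariant under (n, h) ↦ (n + 1, h + 1), and the case h = 0 holds because every
-- bargraph has lch ≥ 1 and lhs ≥ 1.
module Submission where

open import Defs
open import Data.Nat using (ℕ; _≤_; _∸_)
open import Data.Nat.Properties as ℕP using ()
open import Data.Integer as ℤ using (+_)
open import Data.Integer.Properties as ℤP using ()
open import Data.List using (length; filter)
open import Data.Product using (_×_)
open import Relation.Binary.PropositionalEquality using (_≡_)

open import Data.Bool using (Bool; T; true; false; _∧_)
open import Data.Bool.Properties using (T-∧)
open import Data.Empty using (⊥; ⊥-elim)
open import Data.Integer using (ℤ; _⊓_; _≤ᵇ_; +≤+) renaming (_+_ to _+ℤ_; _≤_ to _≤ℤ_; _<_ to _<ℤ_)
open import Data.Integer.Tactic.RingSolver using (solve-∀)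
open import Data.List using (List; []; _∷_; _++_; _∷ʳ_; map; concatMap; initLast; _∷ʳ′_)
import Data.List.Properties as ListP
open import Data.List.Membership.Propositional using (_∈_)
open import Data.List.Membership.Propositional.Properties
  using (∈-∃++; ∈-filter⁻; ∈-filter⁺; ∈-++⁻; ∈-++⁺ˡ; ∈-++⁺ʳ)
open import Data.List.Relation.Unary.All as All using (All; []; _∷_)
import Data.List.Relation.Unary.All.Properties as AllP
open import Data.List.Relation.Unary.AllPairs using ([]; _∷_)
open import Data.List.Relation.Unary.Any using (here; there)
open import Data.List.Relation.Unary.Unique.Propositional using (Unique)
import Data.List.Relation.Unary.Unique.Propositional.Properties as UniqueP
open import Data.Nat using (zero; suc; _+_; _*_; _<_; _≡ᵇ_; z≤n; s≤s)
open import Data.Product using (∃; ∃₂; _,_; proj₁; uncurry)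
open import Data.Sum using (_⊎_; inj₁; inj₂)
open import Function using (_∘_; _⇔_; mk⇔; Equivalence)
open import Level using (0ℓ)
open import Relation.Binary.PropositionalEquality using (refl; sym; trans; cong; cong₂; subst; subst₂; _≢_; module ≡-Reasoning)
open import Relation.Nullary using (¬_; yes; no)
open import Relation.Nullary.Decidable using (T?)
open import Relation.Unary using (Pred; Decidable)

-- Counting duplicate-free lists

∈-delete : ∀ {A : Set} {z v : A} us {vs} → z ∈ us ++ v ∷ vs → z ≢ v → z ∈ us ++ vs
∈-delete []       (here refl) z≢v = ⊥-elim (z≢v refl)
∈-delete []       (there z∈)  _   = z∈
∈-delete (u ∷ us) (here refl) _   = here refl
∈-delete (u ∷ us) (there z∈)  z≢v = there (∈-delete us z∈ z≢v)

length-≤-of-injection : ∀ {A B : Set} {xs : List A} {ys : List B} (f : A → B) → Unique xs →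
  (∀ {x} → x ∈ xs → f x ∈ ys) →
  (∀ {x x′} → x ∈ xs → x′ ∈ xs → f x ≡ f x′ → x ≡ x′) →
  length xs ≤ length ys
length-≤-of-injection {xs = []} f _ _ _ = z≤n
length-≤-of-injection {xs = x ∷ xs} f (x∉xs ∷ xs!) maps-to inj
  with us , vs , refl ← ∈-∃++ (maps-to (here refl)) =
  ℕP.≤-trans
    (s≤s (length-≤-of-injection f xs! maps-into-rest (λ p q → inj (there p) (there q))))
    (ℕP.≤-reflexive (sym (ListP.length-++-sucʳ us (f x) vs)))
  where
  maps-into-rest : ∀ {x′} → x′ ∈ xs → f x′ ∈ us ++ vs
  maps-into-rest x′∈ = ∈-delete us (maps-to (there x′∈))
    (λ fx′≡fx → All.lookup x∉xs x′∈ (sym (inj (there x′∈) (here refl) fx′≡fx)))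

length-≡-of-inverses : ∀ {A B : Set} {xs : List A} {ys : List B} (f : A → B) (g : B → A) →
  Unique xs → Unique ys →
  (∀ {x} → x ∈ xs → f x ∈ ys) → (∀ {y} → y ∈ ys → g y ∈ xs) →
  (∀ {x} → x ∈ xs → g (f x) ≡ x) → (∀ {y} → y ∈ ys → f (g y) ≡ y) →
  length xs ≡ length ys
length-≡-of-inverses f g xs! ys! f∈ g∈ gf fg = ℕP.≤-antisym
  (length-≤-of-injection f xs! f∈ (λ p q eq → trans (sym (gf p)) (trans (cong g eq) (gf q))))
  (length-≤-of-injection g ys! g∈ (λ p q eq → trans (sym (fg p)) (trans (cong f eq) (fg q))))

length-filter-⊎ : ∀ {A : Set} {P Q R : Pred A 0ℓ} (P? : Decidable P) (Q? : Decidable Q) (R? : Decidable R) →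
  (∀ {x} → R x → P x ⊎ Q x) → (∀ {x} → P x → R x) → (∀ {x} → Q x → R x) →
  (∀ {x} → P x → Q x → ⊥) →
  ∀ xs → length (filter P? xs) + length (filter Q? xs) ≡ length (filter R? xs)
length-filter-⊎ P? Q? R? R⇒P⊎Q P⇒R Q⇒R disjoint = go
  where
  go : ∀ xs → length (filter P? xs) + length (filter Q? xs) ≡ length (filter R? xs)
  go [] = refl
  go (x ∷ xs) with P? x | Q? x | R? x
  ... | yes p | yes q | _     = ⊥-elim (disjoint p q)
  ... | yes _ | no _  | yes _ = cong suc (go xs)
  ... | no _  | yes _ | yes _ = trans (ℕP.+-suc _ _) (cong suc (go xs))
  ... | no _  | no _  | no _  = go xs
  ... | yes p | no _  | no ¬r = ⊥-elim (¬r (P⇒R p))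
  ... | no _  | yes q | no ¬r = ⊥-elim (¬r (Q⇒R q))
  ... | no ¬p | no ¬q | yes r with R⇒P⊎Q r
  ...   | inj₁ p = ⊥-elim (¬p p)
  ...   | inj₂ q = ⊥-elim (¬q q)

point-counts-≡ : (eq₁ eq₂ gt₁ gt₂ : ℕ → ℕ) → eq₁ 0 ≡ eq₂ 0 → (∀ j → gt₁ j ≡ gt₂ j) →
  (∀ j → eq₁ (suc j) + gt₁ (suc j) ≡ gt₁ j) → (∀ j → eq₂ (suc j) + gt₂ (suc j) ≡ gt₂ j) →
  ∀ k → eq₁ k ≡ eq₂ k
point-counts-≡ eq₁ eq₂ gt₁ gt₂ eq₁0≡eq₂0 gt₁≡gt₂ split₁ split₂ zero = eq₁0≡eq₂0
point-counts-≡ eq₁ eq₂ gt₁ gt₂ eq₁0≡eq₂0 gt₁≡gt₂ split₁ split₂ (suc j) =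
  ℕP.+-cancelʳ-≡ (gt₁ (suc j)) _ _ (begin
    eq₁ (suc j) + gt₁ (suc j) ≡⟨ split₁ j ⟩
    gt₁ j                     ≡⟨ gt₁≡gt₂ j ⟩
    gt₂ j                     ≡⟨ sym (split₂ j) ⟩
    eq₂ (suc j) + gt₂ (suc j) ≡⟨ cong (λ m → eq₂ (suc j) + m) (sym (gt₁≡gt₂ (suc j))) ⟩
    eq₂ (suc j) + gt₁ (suc j) ∎)
  where open ≡-Reasoning

Pos : ℤ → Set
Pos y = + 1 ≤ℤ y

NonNeg : ℤ → Set
NonNeg y = + 0 ≤ℤ y

¬Pos-0 : ¬ Pos (+ 0)
¬Pos-0 (+≤+ ())

Pos⇒NonNeg : ∀ {y} → Pos y → NonNeg y
Pos⇒NonNeg = ℤP.≤-trans (+≤+ z≤n)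

NonNeg⇒Pos-1+ : ∀ {y} → NonNeg y → Pos (+ 1 +ℤ y)
NonNeg⇒Pos-1+ = ℤP.+-monoʳ-≤ (+ 1)

Pos⇒+1≢0 : ∀ {x} → Pos x → x +ℤ + 1 ≢ + 0
Pos⇒+1≢0 p eq with subst (+ 2 ≤ℤ_) eq (ℤP.+-monoˡ-≤ (+ 1) p)
... | +≤+ ()

-c+[c+z]≡z : ∀ c z → ℤ.- c +ℤ (c +ℤ z) ≡ z
-c+[c+z]≡z c z = trans (sym (ℤP.+-assoc (ℤ.- c) c z)) (trans (cong (_+ℤ z) (ℤP.+-inverseˡ c)) (ℤP.+-identityˡ z))

+-cancelˡ-≤ : ∀ c {x y} → c +ℤ x ≤ℤ c +ℤ y → x ≤ℤ y
+-cancelˡ-≤ c {x} {y} = subst₂ _≤ℤ_ (-c+[c+z]≡z c x) (-c+[c+z]≡z c y) ∘ ℤP.+-monoʳ-≤ (ℤ.- c)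

+-cancelˡ-< : ∀ c {x y} → c +ℤ x <ℤ c +ℤ y → x <ℤ y
+-cancelˡ-< c {x} {y} = subst₂ _<ℤ_ (-c+[c+z]≡z c x) (-c+[c+z]≡z c y) ∘ ℤP.+-monoʳ-< (ℤ.- c)

-- Geometry of words

height-++ : ∀ A B → height (A ++ B) ≡ height A +ℤ height B
height-++ []      B = sym (ℤP.+-identityˡ _)
height-++ (s ∷ A) B = trans (cong (δ s +ℤ_) (height-++ A B)) (sym (ℤP.+-assoc (δ s) _ _))

visited-++ : ∀ y A B → visited y (A ++ B) ≡ visited y A ++ visited (y +ℤ height A) B
visited-++ y []      B = cong (λ z → visited z B) (sym (ℤP.+-identityʳ y))
visited-++ y (s ∷ A) B = cong ((y +ℤ δ s) ∷_) (trans (visited-++ (y +ℤ δ s) A B)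
  (cong (λ z → visited (y +ℤ δ s) A ++ visited z B) (ℤP.+-assoc y (δ s) (height A))))

hHeights-++ : ∀ y A B → hHeights y (A ++ B) ≡ hHeights y A ++ hHeights (y +ℤ height A) B
hHeights-++ y []      B = cong (λ z → hHeights z B) (sym (ℤP.+-identityʳ y))
hHeights-++ y (H ∷ A) B = cong (y ∷_) (trans (hHeights-++ y A B)
  (cong (λ z → hHeights y A ++ hHeights (y +ℤ z) B) (sym (ℤP.+-identityˡ (height A)))))
hHeights-++ y (U ∷ A) B = trans (hHeights-++ (y +ℤ δ U) A B)
  (cong (λ z → hHeights (y +ℤ δ U) A ++ hHeights z B) (ℤP.+-assoc y (δ U) (height A)))
hHeights-++ y (D ∷ A) B = trans (hHeights-++ (y +ℤ δ D) A B)
  (cong (λ z → hHeights (y +ℤ δ D) A ++ hHeights z B) (ℤP.+-assoc y (δ D) (height A)))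

visited-shift : ∀ c y A → visited (c +ℤ y) A ≡ map (c +ℤ_) (visited y A)
visited-shift c y []      = refl
visited-shift c y (s ∷ A) rewrite ℤP.+-assoc c y (δ s) = cong (c +ℤ (y +ℤ δ s) ∷_) (visited-shift c (y +ℤ δ s) A)

hHeights-shift : ∀ c y A → hHeights (c +ℤ y) A ≡ map (c +ℤ_) (hHeights y A)
hHeights-shift c y []      = refl
hHeights-shift c y (H ∷ A) = cong (c +ℤ y ∷_) (hHeights-shift c y A)
hHeights-shift c y (U ∷ A) rewrite ℤP.+-assoc c y (δ U) = hHeights-shift c (y +ℤ δ U) A
hHeights-shift c y (D ∷ A) rewrite ℤP.+-assoc c y (δ D) = hHeights-shift c (y +ℤ δ D) A

visited-H : ∀ y A → visited y (H ∷ A) ≡ y ∷ visited y A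
visited-H y A = cong (λ z → z ∷ visited z A) (ℤP.+-identityʳ y)

init-++-∷ : ∀ {A : Set} (xs : List A) y ys → init (xs ++ y ∷ ys) ≡ xs ++ init (y ∷ ys)
init-++-∷ []           y ys = refl
init-++-∷ (x ∷ [])     y ys = refl
init-++-∷ (x ∷ x′ ∷ xs) y ys = cong (x ∷_) (init-++-∷ (x′ ∷ xs) y ys)

init-∷ʳ : ∀ {A : Set} (xs : List A) x → init (xs ∷ʳ x) ≡ xs
init-∷ʳ xs x = trans (init-++-∷ xs x []) (ListP.++-identityʳ xs)

init-visited-∷ʳ : ∀ y A s → init (visited y (A ∷ʳ s)) ≡ visited y A
init-visited-∷ʳ y A s = trans (cong init (visited-++ y A (s ∷ []))) (init-∷ʳ (visited y A) _)

visited-∷ʳ-endpoint : ∀ y s A → visited y (s ∷ A) ≡ init (visited y (s ∷ A)) ∷ʳ (y +ℤ height (s ∷ A))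
visited-∷ʳ-endpoint y s []      = cong (λ z → (y +ℤ z) ∷ []) (sym (ℤP.+-identityʳ (δ s)))
visited-∷ʳ-endpoint y s (t ∷ A) = cong ((y +ℤ δ s) ∷_) (trans (visited-∷ʳ-endpoint (y +ℤ δ s) t A)
  (cong (λ z → init (visited (y +ℤ δ s) (t ∷ A)) ∷ʳ z) (ℤP.+-assoc y (δ s) (height (t ∷ A)))))

endpoint-∈-visited : ∀ y s A → y +ℤ height (s ∷ A) ∈ visited y (s ∷ A)
endpoint-∈-visited y s A = subst (y +ℤ height (s ∷ A) ∈_) (sym (visited-∷ʳ-endpoint y s A))
  (∈-++⁺ʳ (init (visited y (s ∷ A))) (here refl))

noUDorDU-tail : ∀ s w → T (noUDorDU (s ∷ w)) → T (noUDorDU w)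
noUDorDU-tail H w       ok = ok
noUDorDU-tail U []      ok = ok
noUDorDU-tail U (U ∷ w) ok = ok
noUDorDU-tail U (H ∷ w) ok = ok
noUDorDU-tail D []      ok = ok
noUDorDU-tail D (H ∷ w) ok = ok
noUDorDU-tail D (D ∷ w) ok = ok

noUDorDU-++⁻ˡ : ∀ A B → T (noUDorDU (A ++ B)) → T (noUDorDU A)
noUDorDU-++⁻ˡ []          B _  = _
noUDorDU-++⁻ˡ (H ∷ A)     B ok = noUDorDU-++⁻ˡ A B ok
noUDorDU-++⁻ˡ (U ∷ [])    B _  = _
noUDorDU-++⁻ˡ (U ∷ U ∷ A) B ok = noUDorDU-++⁻ˡ (U ∷ A) B ok
noUDorDU-++⁻ˡ (U ∷ H ∷ A) B ok = noUDorDU-++⁻ˡ (H ∷ A) B ok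
noUDorDU-++⁻ˡ (D ∷ [])    B _  = _
noUDorDU-++⁻ˡ (D ∷ D ∷ A) B ok = noUDorDU-++⁻ˡ (D ∷ A) B ok
noUDorDU-++⁻ˡ (D ∷ H ∷ A) B ok = noUDorDU-++⁻ˡ (H ∷ A) B ok

noUDorDU-repeat : ∀ A s B → noUDorDU (A ++ s ∷ s ∷ B) ≡ noUDorDU (A ++ s ∷ B)
noUDorDU-repeat []          U B = refl
noUDorDU-repeat []          H B = refl
noUDorDU-repeat []          D B = refl
noUDorDU-repeat (H ∷ A)     s B = noUDorDU-repeat A s B
noUDorDU-repeat (U ∷ [])    U B = refl
noUDorDU-repeat (U ∷ [])    H B = refl
noUDorDU-repeat (U ∷ [])    D B = refl
noUDorDU-repeat (U ∷ U ∷ A) s B = noUDorDU-repeat (U ∷ A) s B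
noUDorDU-repeat (U ∷ H ∷ A) s B = noUDorDU-repeat (H ∷ A) s B
noUDorDU-repeat (U ∷ D ∷ A) s B = refl
noUDorDU-repeat (D ∷ [])    U B = refl
noUDorDU-repeat (D ∷ [])    H B = refl
noUDorDU-repeat (D ∷ [])    D B = refl
noUDorDU-repeat (D ∷ D ∷ A) s B = noUDorDU-repeat (D ∷ A) s B
noUDorDU-repeat (D ∷ H ∷ A) s B = noUDorDU-repeat (H ∷ A) s B
noUDorDU-repeat (D ∷ U ∷ A) s B = refl

-- Bargraphs

record IsBargraph (w : Word) : Set where
  constructor mkBargraph
  field
    nonempty     : T (nonEmpty w)
    ends-on-axis : height w ≡ + 0
    interior-pos : All Pos (init (visited (+ 0) w))
    H-pos        : All Pos (hHeights (+ 0) w)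
    no-UD-DU     : T (noUDorDU w)
open IsBargraph

T-allᵇ⁻ : ∀ {A : Set} {p : A → Bool} xs → T (allᵇ p xs) → All (T ∘ p) xs
T-allᵇ⁻ []       _ = []
T-allᵇ⁻ (_ ∷ xs) t = let px , rest = Equivalence.to T-∧ t in px ∷ T-allᵇ⁻ xs rest

T-allᵇ⁺ : ∀ {A : Set} {p : A → Bool} {xs} → All (T ∘ p) xs → T (allᵇ p xs)
T-allᵇ⁺ []         = _
T-allᵇ⁺ (px ∷ pxs) = Equivalence.from T-∧ (px , T-allᵇ⁺ pxs)

T-==ℤ⁻ : ∀ {x y} → T (x ==ℤ y) → x ≡ y
T-==ℤ⁻ t = let x≤y , y≤x = Equivalence.to T-∧ t in ℤP.≤-antisym (ℤP.≤ᵇ⇒≤ x≤y) (ℤP.≤ᵇ⇒≤ y≤x)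

T-==ℤ⁺ : ∀ {x y} → x ≡ y → T (x ==ℤ y)
T-==ℤ⁺ {x} refl = Equivalence.from (T-∧ {x ≤ᵇ x} {x ≤ᵇ x}) (x≤ᵇx , x≤ᵇx)
  where x≤ᵇx = ℤP.≤⇒≤ᵇ (ℤP.≤-refl {x})

isBargraph⇔IsBargraph : ∀ w → T (isBargraph w) ⇔ IsBargraph w
isBargraph⇔IsBargraph w = mk⇔ to from
  where
  to : T (isBargraph w) → IsBargraph w
  to t =
    let ne , t₁ = Equivalence.to T-∧ t
        closed , t₂ = Equivalence.to T-∧ t₁
        interior , t₃ = Equivalence.to T-∧ t₂
        plateaus , noUD = Equivalence.to T-∧ t₃
    in mkBargraph ne (T-==ℤ⁻ closed) (All.map ℤP.≤ᵇ⇒≤ (T-allᵇ⁻ _ interior))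
         (All.map ℤP.≤ᵇ⇒≤ (T-allᵇ⁻ _ plateaus)) noUD
  from : IsBargraph w → T (isBargraph w)
  from (mkBargraph ne closed interior plateaus noUD) =
    Equivalence.from T-∧ (ne , Equivalence.from T-∧ (T-==ℤ⁺ closed ,
      Equivalence.from T-∧ (T-allᵇ⁺ (All.map ℤP.≤⇒≤ᵇ interior) ,
        Equivalence.from T-∧ (T-allᵇ⁺ (All.map ℤP.≤⇒≤ᵇ plateaus) , noUD))))

starts-with-U : ∀ {A} → IsBargraph A → ∃ λ A′ → A ≡ U ∷ A′
starts-with-U {[]}        (mkBargraph () _ _ _ _)
starts-with-U {U ∷ A}     _ = A , refl
starts-with-U {H ∷ A}     (mkBargraph _ _ _ (p ∷ _) _) = ⊥-elim (¬Pos-0 p)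
starts-with-U {D ∷ []}    (mkBargraph _ () _ _ _)
starts-with-U {D ∷ _ ∷ _} (mkBargraph _ _ (() ∷ _) _ _)

last-step-D : ∀ A t → IsBargraph (A ∷ʳ t) → t ≡ D
last-step-D A D _ = refl
last-step-D A H b = ⊥-elim (¬Pos-0 (subst Pos z≡0 (All.lookup H-pos′ (∈-++⁺ʳ (hHeights (+ 0) A) (here refl)))))
  where
  H-pos′ : All Pos (hHeights (+ 0) A ++ (+ 0 +ℤ height A) ∷ [])
  H-pos′ = subst (All Pos) (hHeights-++ (+ 0) A (H ∷ [])) (H-pos b)
  z≡0 : + 0 +ℤ height A ≡ + 0
  z≡0 = trans (ℤP.+-identityˡ (height A))
    (trans (sym (ℤP.+-identityʳ (height A))) (trans (sym (height-++ A (H ∷ []))) (ends-on-axis b)))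
last-step-D []      U (mkBargraph _ () _ _ _)
last-step-D (s ∷ A) U b = ⊥-elim (Pos⇒+1≢0 endpoint-pos (trans (sym (height-++ (s ∷ A) (U ∷ []))) (ends-on-axis b)))
  where
  visited-pos : All Pos (visited (+ 0) (s ∷ A))
  visited-pos = subst (All Pos) (init-visited-∷ʳ (+ 0) (s ∷ A) U) (interior-pos b)
  endpoint-pos : Pos (height (s ∷ A))
  endpoint-pos = subst Pos (ℤP.+-identityˡ _) (All.lookup visited-pos (endpoint-∈-visited (+ 0) s A))

ends-with-D : ∀ {A} → IsBargraph A → ∃ λ A′ → A ≡ A′ ∷ʳ D
ends-with-D {A} b with initLast A
ends-with-D b | []       = ⊥-elim (nonempty b)
ends-with-D b | A′ ∷ʳ′ t with last-step-D A′ t b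
... | refl = A′ , refl

rise-height : ∀ y w → hHeights y (U ∷ w) ≡ [] → T (noUDorDU (U ∷ w)) → height (U ∷ w) ≡ + suc (length w)
rise-height y []      _  _  = refl
rise-height y (U ∷ w) eq ok = cong (+ 1 +ℤ_) (rise-height (y +ℤ + 1) w eq ok)

has-H : ∀ {A} → IsBargraph A → ∃₂ λ y ys → hHeights (+ 0) A ≡ y ∷ ys
has-H b with starts-with-U b
... | A′ , refl with hHeights (+ 0) (U ∷ A′) in eq
...   | y ∷ ys = y , ys , refl
...   | []     with () ← trans (sym (rise-height (+ 0) A′ eq (no-UD-DU b))) (ends-on-axis b)

visited-NonNeg : ∀ {A} → IsBargraph A → All NonNeg (visited (+ 0) A)
visited-NonNeg {[]}    _ = []
visited-NonNeg {s ∷ A} b = subst (All NonNeg) (sym (visited-∷ʳ-endpoint (+ 0) s A))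
  (AllP.++⁺ (All.map Pos⇒NonNeg (interior-pos b))
    (subst NonNeg (sym (trans (ℤP.+-identityˡ _) (ends-on-axis b))) (+≤+ z≤n) ∷ []))

-- Leaving height 0 again would need an H step there or a valley D U.
interior-Pos : ∀ y w → Pos y → All NonNeg (visited y w) → All Pos (hHeights y w) → T (noUDorDU w) →
  All Pos (init (visited y w))
interior-Pos y []          _  _        _   _  = []
interior-Pos y (s ∷ [])    _  _        _   _  = []
interior-Pos y (U ∷ t ∷ w) py (_ ∷ nn) hs ok =
  py′ ∷ interior-Pos (y +ℤ + 1) (t ∷ w) py′ nn hs (noUDorDU-tail U (t ∷ w) ok)
  where py′ = ℤP.≤-trans py (ℤP.i≤i+j y (+ 1))
interior-Pos y (H ∷ t ∷ w) py (_ ∷ nn) (_ ∷ hs) ok = py′ ∷ interior-Pos (y +ℤ + 0) (t ∷ w) py′ nn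
    (subst (λ z → All Pos (hHeights z (t ∷ w))) (sym (ℤP.+-identityʳ y)) hs) ok
  where py′ = subst Pos (sym (ℤP.+-identityʳ y)) py
interior-Pos (+ suc (suc k)) (D ∷ t ∷ w) _ (_ ∷ nn) hs ok =
  +≤+ (s≤s z≤n) ∷ interior-Pos (+ suc k) (t ∷ w) (+≤+ (s≤s z≤n)) nn hs (noUDorDU-tail D (t ∷ w) ok)
interior-Pos (+ 1) (D ∷ U ∷ w) _ _            _       ()
interior-Pos (+ 1) (D ∷ H ∷ w) _ _            (p ∷ _) _ = ⊥-elim (¬Pos-0 p)
interior-Pos (+ 1) (D ∷ D ∷ w) _ (_ ∷ () ∷ _) _       _

minimum-≤ : ∀ x ys → All (minimum x ys ≤ℤ_) (x ∷ ys)
minimum-≤ x []       = ℤP.≤-refl ∷ []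
minimum-≤ x (y ∷ ys) with m≤x⊓y ∷ m≤ys ← minimum-≤ (x ⊓ y) ys =
  ℤP.≤-trans m≤x⊓y (ℤP.i⊓j≤i x y) ∷ ℤP.≤-trans m≤x⊓y (ℤP.i⊓j≤j x y) ∷ m≤ys

minimum-glb : ∀ {m} x ys → All (m ≤ℤ_) (x ∷ ys) → m ≤ℤ minimum x ys
minimum-glb x []       (m≤x ∷ _)          = m≤x
minimum-glb x (y ∷ ys) (m≤x ∷ m≤y ∷ m≤ys) = minimum-glb (x ⊓ y) ys (ℤP.⊓-glb m≤x m≤y ∷ m≤ys)

minimum-map : ∀ {f : ℤ → ℤ} → (∀ {a b} → a ≤ℤ b → f a ≤ℤ f b) →
  ∀ x ys → minimum (f x) (map f ys) ≡ f (minimum x ys)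
minimum-map         mono x []       = refl
minimum-map {f = f} mono x (y ∷ ys) rewrite sym (ℤP.mono-≤-distrib-⊓ {f} mono x y) = minimum-map mono (x ⊓ y) ys

lch-∷ : ∀ w {y ys} → hHeights (+ 0) w ≡ y ∷ ys → lch w ≡ minimum y ys
lch-∷ w eq with hHeights (+ 0) w
lch-∷ w refl | _ = refl

lch-Pos : ∀ {A} → IsBargraph A → Pos (lch A)
lch-Pos {A} b with y , ys , eq ← has-H b =
  subst Pos (sym (lch-∷ A eq)) (minimum-glb y ys (subst (All Pos) eq (H-pos b)))

lch-≤-H : ∀ {A} → IsBargraph A → All (lch A ≤ℤ_) (hHeights (+ 0) A)
lch-≤-H b with y , ys , eq ← has-H b rewrite eq = minimum-≤ y ys

lhs-Pos : ∀ {A} → IsBargraph A → 0 < lhs A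
lhs-Pos {A} b with y , ys , eq ← has-H b = go (+ 0) A eq
  where
  go : ∀ z w → hHeights z w ≡ y ∷ ys → 0 < lhs w
  go z (H ∷ w) _  = s≤s z≤n
  go z (U ∷ w) eq = go (z +ℤ δ U) w eq
  go z (D ∷ w) eq = go (z +ℤ δ D) w eq

-- Raising a bargraph

count-++ : ∀ s A B → count s (A ++ B) ≡ count s A + count s B
count-++ s []      B = refl
count-++ s (t ∷ A) B with s ==s t
... | true  = cong suc (count-++ s A B)
... | false = count-++ s A B

semiperimeter-∷ʳ-D : ∀ A → semiperimeter (A ∷ʳ D) ≡ semiperimeter A
semiperimeter-∷ʳ-D A = cong₂ _+_
  (trans (count-++ U A (D ∷ [])) (ℕP.+-identityʳ _)) (trans (count-++ H A (D ∷ [])) (ℕP.+-identityʳ _))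

wrap : Word → Word
wrap A = U ∷ A ∷ʳ D

unwrap : Word → Word
unwrap []      = []
unwrap (_ ∷ A) = init A

unwrap-wrap : ∀ A → unwrap (wrap A) ≡ A
unwrap-wrap A = init-∷ʳ A D

bargraph-is-wrap : ∀ {A} → IsBargraph A → ∃ λ B → A ≡ wrap B
bargraph-is-wrap b with A₁ , refl ← starts-with-U b with ends-with-D b
... | []    , ()
... | _ ∷ B , refl = B , refl

wrap-unwrap : ∀ {A} → IsBargraph A → wrap (unwrap A) ≡ A
wrap-unwrap b with B , refl ← bargraph-is-wrap b = cong wrap (unwrap-wrap B)

semiperimeter-wrap : ∀ A → semiperimeter (wrap A) ≡ suc (semiperimeter A)
semiperimeter-wrap A = cong suc (semiperimeter-∷ʳ-D A)

height-wrap : ∀ A → height (wrap A) ≡ height A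
height-wrap A = trans (cong (+ 1 +ℤ_) (height-++ A (D ∷ []))) (cancel (height A))
  where
  cancel : ∀ h → + 1 +ℤ (h +ℤ (ℤ.- + 1 +ℤ + 0)) ≡ h
  cancel = solve-∀

hHeights-wrap : ∀ A → hHeights (+ 0) (wrap A) ≡ map (+ 1 +ℤ_) (hHeights (+ 0) A)
hHeights-wrap A = trans (hHeights-++ (+ 1) A (D ∷ []))
  (trans (ListP.++-identityʳ _) (hHeights-shift (+ 1) (+ 0) A))

init-visited-wrap : ∀ A → init (visited (+ 0) (wrap A)) ≡ + 1 ∷ map (+ 1 +ℤ_) (visited (+ 0) A)
init-visited-wrap A = begin
  init (+ 1 ∷ visited (+ 1) (A ∷ʳ D))            ≡⟨ cong (λ vs → init (+ 1 ∷ vs)) (visited-++ (+ 1) A (D ∷ [])) ⟩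
  init ((+ 1 ∷ visited (+ 1) A) ∷ʳ _)           ≡⟨ init-∷ʳ (+ 1 ∷ visited (+ 1) A) _ ⟩
  + 1 ∷ visited (+ 1) A                          ≡⟨ cong (+ 1 ∷_) (visited-shift (+ 1) (+ 0) A) ⟩
  + 1 ∷ map (+ 1 +ℤ_) (visited (+ 0) A)          ∎
  where open ≡-Reasoning

lch-wrap : ∀ {A} → IsBargraph A → lch (wrap A) ≡ + 1 +ℤ lch A
lch-wrap {A} b with y , ys , eq ← has-H b = begin
  lch (wrap A)                               ≡⟨ lch-∷ (wrap A) (trans (hHeights-wrap A) (cong (map (+ 1 +ℤ_)) eq)) ⟩
  minimum (+ 1 +ℤ y) (map (+ 1 +ℤ_) ys)      ≡⟨ minimum-map (ℤP.+-monoʳ-≤ (+ 1)) y ys ⟩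
  + 1 +ℤ minimum y ys                        ≡⟨ cong (+ 1 +ℤ_) (sym (lch-∷ A eq)) ⟩
  + 1 +ℤ lch A                               ∎
  where open ≡-Reasoning

wrap-noUDorDU : ∀ {A} → IsBargraph A → T (noUDorDU (wrap A))
wrap-noUDorDU b with A₁ , refl ← starts-with-U b with A′ , eq ← ends-with-D b =
  subst T (sym doubled-last-D) (no-UD-DU b)
  where
  open ≡-Reasoning
  doubled-last-D : noUDorDU (wrap (U ∷ A₁)) ≡ noUDorDU (U ∷ A₁)
  doubled-last-D = begin
    noUDorDU ((U ∷ A₁) ∷ʳ D)      ≡⟨ cong (λ v → noUDorDU (v ∷ʳ D)) eq ⟩
    noUDorDU ((A′ ∷ʳ D) ∷ʳ D)     ≡⟨ cong noUDorDU (ListP.++-assoc A′ (D ∷ []) (D ∷ [])) ⟩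
    noUDorDU (A′ ++ D ∷ D ∷ [])   ≡⟨ noUDorDU-repeat A′ D [] ⟩
    noUDorDU (A′ ∷ʳ D)            ≡⟨ cong noUDorDU (sym eq) ⟩
    noUDorDU (U ∷ A₁)             ∎

wrap-IsBargraph : ∀ {A} → IsBargraph A → IsBargraph (wrap A)
wrap-IsBargraph {A} b = mkBargraph _ (trans (height-wrap A) (ends-on-axis b))
  (subst (All Pos) (sym (init-visited-wrap A)) (ℤP.≤-refl ∷ AllP.map⁺ (All.map NonNeg⇒Pos-1+ (visited-NonNeg b))))
  (subst (All Pos) (sym (hHeights-wrap A)) (AllP.map⁺ (All.map (NonNeg⇒Pos-1+ ∘ Pos⇒NonNeg) (H-pos b))))
  (wrap-noUDorDU b)

unwrap-IsBargraph : ∀ B → IsBargraph (wrap B) → All (+ 2 ≤ℤ_) (hHeights (+ 0) (wrap B)) → IsBargraph B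
unwrap-IsBargraph []          (mkBargraph _ _ _ _ ()) _
unwrap-IsBargraph (D ∷ B)     (mkBargraph _ _ _ _ ()) _
unwrap-IsBargraph (U ∷ [])    (mkBargraph _ _ _ _ ()) _
unwrap-IsBargraph (H ∷ B)     _ (+≤+ (s≤s ()) ∷ _)
unwrap-IsBargraph (U ∷ t ∷ B) b high = mkBargraph _ (trans (sym (height-wrap (U ∷ t ∷ B))) (ends-on-axis b))
  (+≤+ (s≤s z≤n) ∷ interior-Pos (+ 1) (t ∷ B) (+≤+ (s≤s z≤n)) (All.tail nonneg) plateaus
                                (noUDorDU-tail U (t ∷ B) noUD))
  plateaus noUD
  where
  plateaus : All Pos (hHeights (+ 0) (U ∷ t ∷ B))
  plateaus = All.map (+-cancelˡ-≤ (+ 1)) (AllP.map⁻ (subst (All (+ 2 ≤ℤ_)) (hHeights-wrap (U ∷ t ∷ B)) high))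
  noUD : T (noUDorDU (U ∷ t ∷ B))
  noUD = noUDorDU-++⁻ˡ (U ∷ t ∷ B) (D ∷ []) (noUDorDU-tail U ((U ∷ t ∷ B) ∷ʳ D) (no-UD-DU b))
  nonneg : All NonNeg (visited (+ 0) (U ∷ t ∷ B))
  nonneg = All.map (+-cancelˡ-≤ (+ 1))
    (AllP.map⁻ (All.tail (subst (All Pos) (init-visited-wrap (U ∷ t ∷ B)) (interior-pos b))))

-- Widening the first column

nonEmpty-++-∷ : ∀ A s B → T (nonEmpty (A ++ s ∷ B))
nonEmpty-++-∷ []      s B = _
nonEmpty-++-∷ (_ ∷ _) s B = _

height-++-HH : ∀ A B → height (A ++ H ∷ H ∷ B) ≡ height (A ++ H ∷ B)
height-++-HH A B = begin
  height (A ++ H ∷ H ∷ B)             ≡⟨ height-++ A (H ∷ H ∷ B) ⟩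
  height A +ℤ (+ 0 +ℤ height (H ∷ B)) ≡⟨ cong (height A +ℤ_) (ℤP.+-identityˡ _) ⟩
  height A +ℤ height (H ∷ B)          ≡⟨ sym (height-++ A (H ∷ B)) ⟩
  height (A ++ H ∷ B)                 ∎
  where open ≡-Reasoning

init-visited-++-H : ∀ y A B → let z = y +ℤ height A in
  init (visited y (A ++ H ∷ B)) ≡ visited y A ++ init (z ∷ visited z B)
init-visited-++-H y A B = begin
  init (visited y (A ++ H ∷ B))                  ≡⟨ cong init (visited-++ y A (H ∷ B)) ⟩
  init (visited y A ++ visited z (H ∷ B))        ≡⟨ cong (λ vs → init (visited y A ++ vs)) (visited-H z B) ⟩
  init (visited y A ++ z ∷ visited z B)          ≡⟨ init-++-∷ (visited y A) z _ ⟩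
  visited y A ++ init (z ∷ visited z B)          ∎
  where
  open ≡-Reasoning
  z = y +ℤ height A

init-visited-++-HH : ∀ y A B → let z = y +ℤ height A in
  init (visited y (A ++ H ∷ H ∷ B)) ≡ visited y A ++ z ∷ init (z ∷ visited z B)
init-visited-++-HH y A B = begin
  init (visited y (A ++ H ∷ H ∷ B))              ≡⟨ cong init (visited-++ y A (H ∷ H ∷ B)) ⟩
  init (visited y A ++ visited z (H ∷ H ∷ B))    ≡⟨ cong (λ vs → init (visited y A ++ vs)) visited-HH ⟩
  init (visited y A ++ z ∷ z ∷ visited z B)      ≡⟨ init-++-∷ (visited y A) z _ ⟩
  visited y A ++ z ∷ init (z ∷ visited z B)      ∎
  where
  open ≡-Reasoning
  z = y +ℤ height A
  visited-HH : visited z (H ∷ H ∷ B) ≡ z ∷ z ∷ visited z B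
  visited-HH = trans (visited-H z (H ∷ B)) (cong (z ∷_) (visited-H z B))

All-++-insert : ∀ {A : Set} {P : A → Set} xs {z ys} → P z → All P (xs ++ ys) → All P (xs ++ z ∷ ys)
All-++-insert xs pz all = let pxs , pys = AllP.++⁻ xs all in AllP.++⁺ pxs (pz ∷ pys)

All-++-delete : ∀ {A : Set} {P : A → Set} xs {z ys} → All P (xs ++ z ∷ ys) → All P (xs ++ ys)
All-++-delete xs all with pxs , _ ∷ pys ← AllP.++⁻ xs all = AllP.++⁺ pxs pys

IsBargraph-H⇔HH : ∀ A B → IsBargraph (A ++ H ∷ B) ⇔ IsBargraph (A ++ H ∷ H ∷ B)
IsBargraph-H⇔HH A B = mk⇔ widen narrow
  where
  z = + 0 +ℤ height A
  widen : IsBargraph (A ++ H ∷ B) → IsBargraph (A ++ H ∷ H ∷ B)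
  widen (mkBargraph _ closed interior plateaus noUD) =
    mkBargraph (nonEmpty-++-∷ A H (H ∷ B)) (trans (height-++-HH A B) closed)
      (subst (All Pos) (sym (init-visited-++-HH (+ 0) A B))
        (All-++-insert (visited (+ 0) A) pz (subst (All Pos) (init-visited-++-H (+ 0) A B) interior)))
      (subst (All Pos) (sym (hHeights-++ (+ 0) A (H ∷ H ∷ B))) (All-++-insert (hHeights (+ 0) A) pz plateaus′))
      (subst T (sym (noUDorDU-repeat A H B)) noUD)
    where
    plateaus′ : All Pos (hHeights (+ 0) A ++ z ∷ hHeights z B)
    plateaus′ = subst (All Pos) (hHeights-++ (+ 0) A (H ∷ B)) plateaus
    pz : Pos z
    pz = All.head (AllP.++⁻ʳ (hHeights (+ 0) A) plateaus′)
  narrow : IsBargraph (A ++ H ∷ H ∷ B) → IsBargraph (A ++ H ∷ B)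
  narrow (mkBargraph _ closed interior plateaus noUD) =
    mkBargraph (nonEmpty-++-∷ A H B) (trans (sym (height-++-HH A B)) closed)
      (subst (All Pos) (sym (init-visited-++-H (+ 0) A B))
        (All-++-delete (visited (+ 0) A) (subst (All Pos) (init-visited-++-HH (+ 0) A B) interior)))
      (subst (All Pos) (sym (hHeights-++ (+ 0) A (H ∷ B)))
        (All-++-delete (hHeights (+ 0) A) (subst (All Pos) (hHeights-++ (+ 0) A (H ∷ H ∷ B)) plateaus)))
      (subst T (noUDorDU-repeat A H B) noUD)

widenFirst : Word → Word
widenFirst []      = []
widenFirst (H ∷ w) = H ∷ H ∷ w
widenFirst (U ∷ w) = U ∷ widenFirst w
widenFirst (D ∷ w) = D ∷ widenFirst w

narrowFirst : Word → Word
narrowFirst []      = []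
narrowFirst (H ∷ w) = w
narrowFirst (U ∷ w) = U ∷ narrowFirst w
narrowFirst (D ∷ w) = D ∷ narrowFirst w

narrowFirst-widenFirst : ∀ w → narrowFirst (widenFirst w) ≡ w
narrowFirst-widenFirst []      = refl
narrowFirst-widenFirst (H ∷ w) = refl
narrowFirst-widenFirst (U ∷ w) = cong (U ∷_) (narrowFirst-widenFirst w)
narrowFirst-widenFirst (D ∷ w) = cong (D ∷_) (narrowFirst-widenFirst w)

widenFirst-narrowFirst : ∀ w → 1 < lhs w → widenFirst (narrowFirst w) ≡ w
widenFirst-narrowFirst (H ∷ H ∷ w) _ = refl
widenFirst-narrowFirst (H ∷ [])    (s≤s ())
widenFirst-narrowFirst (H ∷ U ∷ w) (s≤s ())
widenFirst-narrowFirst (H ∷ D ∷ w) (s≤s ())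
widenFirst-narrowFirst (U ∷ w)     p = cong (U ∷_) (widenFirst-narrowFirst w p)
widenFirst-narrowFirst (D ∷ w)     p = cong (D ∷_) (widenFirst-narrowFirst w p)

lhs-widenFirst : ∀ w → 0 < lhs w → lhs (widenFirst w) ≡ suc (lhs w)
lhs-widenFirst (H ∷ w) _ = refl
lhs-widenFirst (U ∷ w) p = lhs-widenFirst w p
lhs-widenFirst (D ∷ w) p = lhs-widenFirst w p

lhs-narrowFirst : ∀ w → 1 < lhs w → suc (lhs (narrowFirst w)) ≡ lhs w
lhs-narrowFirst (H ∷ H ∷ w) _ = refl
lhs-narrowFirst (H ∷ [])    (s≤s ())
lhs-narrowFirst (H ∷ U ∷ w) (s≤s ())
lhs-narrowFirst (H ∷ D ∷ w) (s≤s ())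
lhs-narrowFirst (U ∷ w)     p = lhs-narrowFirst w p
lhs-narrowFirst (D ∷ w)     p = lhs-narrowFirst w p

semiperimeter-widenFirst : ∀ w → 0 < lhs w → semiperimeter (widenFirst w) ≡ suc (semiperimeter w)
semiperimeter-widenFirst (H ∷ w) _ = ℕP.+-suc (count U w) (suc (count H w))
semiperimeter-widenFirst (U ∷ w) p = cong suc (semiperimeter-widenFirst w p)
semiperimeter-widenFirst (D ∷ w) p = semiperimeter-widenFirst w p

widenFirst-split : ∀ w → 0 < lhs w → ∃₂ λ A B → w ≡ A ++ H ∷ B × widenFirst w ≡ A ++ H ∷ H ∷ B
widenFirst-split (H ∷ w) _ = [] , w , refl , refl
widenFirst-split (U ∷ w) p with A , B , refl , eq ← widenFirst-split w p = U ∷ A , B , refl , cong (U ∷_) eq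
widenFirst-split (D ∷ w) p with A , B , refl , eq ← widenFirst-split w p = D ∷ A , B , refl , cong (D ∷_) eq

widenFirst-IsBargraph : ∀ {w} → IsBargraph w → IsBargraph (widenFirst w)
widenFirst-IsBargraph {w} b with A , B , refl , eq ← widenFirst-split w (lhs-Pos b) =
  subst IsBargraph (sym eq) (Equivalence.to (IsBargraph-H⇔HH A B) b)

widenFirst-IsBargraph⁻ : ∀ {w} → 0 < lhs w → IsBargraph (widenFirst w) → IsBargraph w
widenFirst-IsBargraph⁻ {w} p b with A , B , refl , eq ← widenFirst-split w p =
  Equivalence.from (IsBargraph-H⇔HH A B) (subst IsBargraph eq b)

-- The enumeration 𝓑

extensions : Word → List Word
extensions w = (U ∷ w) ∷ (H ∷ w) ∷ (D ∷ w) ∷ []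

∈-extensions⁻ : ∀ {v} xs → v ∈ concatMap extensions xs → ∃₂ λ s w → v ≡ s ∷ w × w ∈ xs
∈-extensions⁻ (w ∷ xs) (here refl)                 = U , w , refl , here refl
∈-extensions⁻ (w ∷ xs) (there (here refl))         = H , w , refl , here refl
∈-extensions⁻ (w ∷ xs) (there (there (here refl))) = D , w , refl , here refl
∈-extensions⁻ (w ∷ xs) (there (there (there v∈)))
  with s , w′ , eq , w′∈ ← ∈-extensions⁻ xs v∈ = s , w′ , eq , there w′∈

∈-extensions⁺ : ∀ s {w} xs → w ∈ xs → s ∷ w ∈ concatMap extensions xs
∈-extensions⁺ U (w ∷ xs) (here refl) = here refl
∈-extensions⁺ H (w ∷ xs) (here refl) = there (here refl)
∈-extensions⁺ D (w ∷ xs) (here refl) = there (there (here refl))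
∈-extensions⁺ s (w ∷ xs) (there w∈)  = there (there (there (∈-extensions⁺ s xs w∈)))

extensions-Unique : ∀ xs → Unique xs → Unique (concatMap extensions xs)
extensions-Unique []       _          = []
extensions-Unique (w ∷ xs) (w∉ ∷ xs!) =
  ((λ ()) ∷ (λ ()) ∷ All.tabulate (fresh U)) ∷ ((λ ()) ∷ All.tabulate (fresh H)) ∷ All.tabulate (fresh D)
    ∷ extensions-Unique xs xs!
  where
  fresh : ∀ t {v} → v ∈ concatMap extensions xs → t ∷ w ≢ v
  fresh t v∈ eq with s , w′ , refl , w′∈ ← ∈-extensions⁻ xs v∈ = All.lookup w∉ w′∈ (ListP.∷-injectiveʳ eq)

wordsOfLength-Unique : ∀ k → Unique (wordsOfLength k)
wordsOfLength-Unique zero    = [] ∷ []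
wordsOfLength-Unique (suc k) = extensions-Unique (wordsOfLength k) (wordsOfLength-Unique k)

∈-wordsOfLength⁻ : ∀ k {w} → w ∈ wordsOfLength k → length w ≡ k
∈-wordsOfLength⁻ zero    (here refl) = refl
∈-wordsOfLength⁻ (suc k) w∈ with s , w , refl , w∈′ ← ∈-extensions⁻ (wordsOfLength k) w∈ =
  cong suc (∈-wordsOfLength⁻ k w∈′)

∈-wordsOfLength⁺ : ∀ w → w ∈ wordsOfLength (length w)
∈-wordsOfLength⁺ []      = here refl
∈-wordsOfLength⁺ (s ∷ w) = ∈-extensions⁺ s _ (∈-wordsOfLength⁺ w)

∈-wordsUpTo⁻ : ∀ N {w} → w ∈ wordsUpTo N → length w ≤ N
∈-wordsUpTo⁻ zero    w∈ = ℕP.≤-reflexive (∈-wordsOfLength⁻ zero w∈)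
∈-wordsUpTo⁻ (suc N) w∈ with ∈-++⁻ (wordsOfLength (suc N)) w∈
... | inj₁ w∈′ = ℕP.≤-reflexive (∈-wordsOfLength⁻ (suc N) w∈′)
... | inj₂ w∈′ = ℕP.m≤n⇒m≤1+n (∈-wordsUpTo⁻ N w∈′)

∈-wordsUpTo⁺ : ∀ N w → length w ≤ N → w ∈ wordsUpTo N
∈-wordsUpTo⁺ zero    []      _ = here refl
∈-wordsUpTo⁺ (suc N) w       ≤N with length w ℕP.≟ suc N
... | yes ≡N = ∈-++⁺ˡ (subst (λ k → w ∈ wordsOfLength k) ≡N (∈-wordsOfLength⁺ w))
... | no ≢N  = ∈-++⁺ʳ (wordsOfLength (suc N)) (∈-wordsUpTo⁺ N w (ℕP.≤-pred (ℕP.≤∧≢⇒< ≤N ≢N)))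

wordsUpTo-Unique : ∀ N → Unique (wordsUpTo N)
wordsUpTo-Unique zero    = wordsOfLength-Unique zero
wordsUpTo-Unique (suc N) = UniqueP.++⁺ (wordsOfLength-Unique (suc N)) (wordsUpTo-Unique N)
  λ (w∈long , w∈short) → ℕP.<-irrefl (∈-wordsOfLength⁻ (suc N) w∈long) (s≤s (∈-wordsUpTo⁻ N w∈short))

length-count : ∀ w → length w ≡ count U w + count H w + count D w
length-count []      = refl
length-count (U ∷ w) = cong suc (length-count w)
length-count (H ∷ w) = trans (cong suc (length-count w)) (cong (_+ count D w) (sym (ℕP.+-suc (count U w) (count H w))))
length-count (D ∷ w) = trans (cong suc (length-count w)) (sym (ℕP.+-suc (count U w + count H w) (count D w)))

height-count : ∀ w → height w +ℤ + count D w ≡ + count U w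
height-count []      = refl
height-count (U ∷ w) = trans (ℤP.+-assoc (+ 1) (height w) (+ count D w)) (cong (+ 1 +ℤ_) (height-count w))
height-count (H ∷ w) = trans (cong (_+ℤ + count D w) (ℤP.+-identityˡ (height w))) (height-count w)
height-count (D ∷ w) = trans (cancel (height w) (+ count D w)) (height-count w)
  where
  cancel : ∀ h c → (ℤ.- + 1 +ℤ h) +ℤ (+ 1 +ℤ c) ≡ h +ℤ c
  cancel = solve-∀

length-≤-2*semiperimeter : ∀ {w} → IsBargraph w → length w ≤ 2 * semiperimeter w
length-≤-2*semiperimeter {w} b = begin
  length w                          ≡⟨ length-count w ⟩
  semiperimeter w + count D w       ≡⟨ cong (λ m → semiperimeter w + m) #D≡#U ⟩
  semiperimeter w + count U w       ≤⟨ ℕP.+-monoʳ-≤ (semiperimeter w) (ℕP.m≤m+n (count U w) (count H w)) ⟩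
  semiperimeter w + semiperimeter w ≡⟨ cong (λ m → semiperimeter w + m) (sym (ℕP.+-identityʳ _)) ⟩
  2 * semiperimeter w               ∎
  where
  open ℕP.≤-Reasoning
  #D≡#U : count D w ≡ count U w
  #D≡#U = ℤP.+-injective (trans (cong (_+ℤ + count D w) (sym (ends-on-axis b))) (height-count w))

𝓑-test : ℕ → Word → Bool
𝓑-test n w = isBargraph w ∧ (semiperimeter w ≡ᵇ n)

Bargraph : ℕ → Word → Set
Bargraph n w = IsBargraph w × semiperimeter w ≡ n

∈-𝓑⁻ : ∀ n {w} → w ∈ 𝓑 n → Bargraph n w
∈-𝓑⁻ n {w} w∈ with _ , t ← ∈-filter⁻ (T? ∘ 𝓑-test n) {xs = wordsUpTo (2 * n)} w∈ =
  let bar , sp = Equivalence.to T-∧ t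
  in Equivalence.to (isBargraph⇔IsBargraph w) bar , ℕP.≡ᵇ⇒≡ _ _ sp

∈-𝓑⁺ : ∀ n {w} → Bargraph n w → w ∈ 𝓑 n
∈-𝓑⁺ n {w} (b , refl) = ∈-filter⁺ (T? ∘ 𝓑-test n)
  (∈-wordsUpTo⁺ (2 * n) w (length-≤-2*semiperimeter b))
  (Equivalence.from T-∧ (Equivalence.from (isBargraph⇔IsBargraph w) b , ℕP.≡⇒≡ᵇ n n refl))

𝓑-Unique : ∀ n → Unique (𝓑 n)
𝓑-Unique n = UniqueP.filter⁺ (T? ∘ 𝓑-test n) (wordsUpTo-Unique (2 * n))

-- Tail counts

length-filter-𝓑-≡ : ∀ {P Q : Pred Word 0ℓ} (P? : Decidable P) (Q? : Decidable Q) (f g : Word → Word) n →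
  (∀ {w} → Bargraph n w → P w → Bargraph (suc n) (f w) × Q (f w)) →
  (∀ {w} → Bargraph (suc n) w → Q w → Bargraph n (g w) × P (g w)) →
  (∀ w → g (f w) ≡ w) →
  (∀ {w} → Bargraph (suc n) w → Q w → f (g w) ≡ w) →
  length (filter P? (𝓑 n)) ≡ length (filter Q? (𝓑 (suc n)))
length-filter-𝓑-≡ P? Q? f g n f-maps g-maps gf fg = length-≡-of-inverses f g
  (UniqueP.filter⁺ P? (𝓑-Unique n)) (UniqueP.filter⁺ Q? (𝓑-Unique (suc n)))
  (λ w∈ → into Q? (uncurry f-maps (out P? w∈))) (λ w∈ → into P? (uncurry g-maps (out Q? w∈)))
  (λ {w} _ → gf w) (λ w∈ → uncurry fg (out Q? w∈))
  where
  out : ∀ {m} {R : Pred Word 0ℓ} (R? : Decidable R) {w} → w ∈ filter R? (𝓑 m) → Bargraph m w × R w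
  out {m} R? w∈ = let w∈𝓑 , r = ∈-filter⁻ R? {xs = 𝓑 m} w∈ in ∈-𝓑⁻ m w∈𝓑 , r
  into : ∀ {m} {R : Pred Word 0ℓ} (R? : Decidable R) {w} → Bargraph m w × R w → w ∈ filter R? (𝓑 m)
  into {m} R? (bw , r) = ∈-filter⁺ R? (∈-𝓑⁺ m bw) r

lch-shift : ∀ n h → length (filter (λ A → + h ℤP.<? lch A) (𝓑 n))
                  ≡ length (filter (λ A → + suc h ℤP.<? lch A) (𝓑 (suc n)))
lch-shift n h = length-filter-𝓑-≡ _ _ wrap unwrap n raise lower unwrap-wrap (λ (b , _) _ → wrap-unwrap b)
  where
  raise : ∀ {w} → Bargraph n w → + h <ℤ lch w → Bargraph (suc n) (wrap w) × + suc h <ℤ lch (wrap w)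
  raise {w} (b , refl) h<lch =
    (wrap-IsBargraph b , semiperimeter-wrap w) , subst (+ suc h <ℤ_) (sym (lch-wrap b)) (ℤP.+-monoʳ-< (+ 1) h<lch)
  lower : ∀ {w} → Bargraph (suc n) w → + suc h <ℤ lch w → Bargraph n (unwrap w) × + h <ℤ lch (unwrap w)
  lower (b , sp) sh<lch with B , refl ← bargraph-is-wrap b rewrite unwrap-wrap B =
    (b′ , ℕP.suc-injective (trans (sym (semiperimeter-wrap B)) sp)) ,
    +-cancelˡ-< (+ 1) (subst (+ suc h <ℤ_) (lch-wrap b′) sh<lch)
    where
    2≤lch : + 2 ≤ℤ lch (wrap B)
    2≤lch = ℤP.≤-trans (+≤+ (s≤s (s≤s z≤n))) (ℤP.i<j⇒suc[i]≤j sh<lch)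
    b′ : IsBargraph B
    b′ = unwrap-IsBargraph B b (All.map (ℤP.≤-trans 2≤lch) (lch-≤-H b))

lhs-shift : ∀ n h → length (filter (λ A → h ℕP.<? lhs A) (𝓑 n))
                  ≡ length (filter (λ A → suc h ℕP.<? lhs A) (𝓑 (suc n)))
lhs-shift n h = length-filter-𝓑-≡ _ _ widenFirst narrowFirst n widen narrow narrowFirst-widenFirst
  (λ {w} _ sh<lhs → widenFirst-narrowFirst w (1<lhs w sh<lhs))
  where
  1<lhs : ∀ w → suc h < lhs w → 1 < lhs w
  1<lhs _ = ℕP.≤-trans (s≤s (s≤s z≤n))
  widen : ∀ {w} → Bargraph n w → h < lhs w → Bargraph (suc n) (widenFirst w) × suc h < lhs (widenFirst w)
  widen {w} (b , refl) h<lhs = (widenFirst-IsBargraph b , semiperimeter-widenFirst w (lhs-Pos b)) ,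
    subst (suc h <_) (sym (lhs-widenFirst w (lhs-Pos b))) (s≤s h<lhs)
  narrow : ∀ {w} → Bargraph (suc n) w → suc h < lhs w → Bargraph n (narrowFirst w) × h < lhs (narrowFirst w)
  narrow {w} (b , sp) sh<lhs = (b′ , ℕP.suc-injective sp′) , ℕP.≤-pred (subst (suc h <_) (sym lhs≡) sh<lhs)
    where
    lhs≡ : suc (lhs (narrowFirst w)) ≡ lhs w
    lhs≡ = lhs-narrowFirst w (1<lhs w sh<lhs)
    0<lhs : 0 < lhs (narrowFirst w)
    0<lhs = ℕP.≤-pred (subst (1 <_) (sym lhs≡) (1<lhs w sh<lhs))
    widen-narrow : widenFirst (narrowFirst w) ≡ w
    widen-narrow = widenFirst-narrowFirst w (1<lhs w sh<lhs)
    b′ : IsBargraph (narrowFirst w)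
    b′ = widenFirst-IsBargraph⁻ 0<lhs (subst IsBargraph (sym widen-narrow) b)
    sp′ : suc (semiperimeter (narrowFirst w)) ≡ suc n
    sp′ = trans (sym (semiperimeter-widenFirst (narrowFirst w) 0<lhs)) (trans (cong semiperimeter widen-narrow) sp)

lch-tail-count : ∀ n h → length (filter (λ A → + h ℤP.<? lch A) (𝓑 n)) ≡ length (𝓑 (n ∸ h))
lch-tail-count n       zero    = cong length (ListP.filter-all _ (All.tabulate (λ A∈ →
  ℤP.suc[i]≤j⇒i<j (lch-Pos (proj₁ (∈-𝓑⁻ n A∈))))))
lch-tail-count zero    (suc h) = refl  -- 𝓑 0 evaluates to []
lch-tail-count (suc n) (suc h) = trans (sym (lch-shift n h)) (lch-tail-count n h)

lhs-tail-count : ∀ n h → length (filter (λ A → h ℕP.<? lhs A) (𝓑 n)) ≡ length (𝓑 (n ∸ h))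
lhs-tail-count n       zero    = cong length (ListP.filter-all _ (All.tabulate (λ A∈ → lhs-Pos (proj₁ (∈-𝓑⁻ n A∈)))))
lhs-tail-count zero    (suc h) = refl
lhs-tail-count (suc n) (suc h) = trans (sym (lhs-shift n h)) (lhs-tail-count n h)

lch-level-split : ∀ n j → length (filter (λ A → lch A ℤP.≟ + suc j) (𝓑 n))
                        + length (filter (λ A → + suc j ℤP.<? lch A) (𝓑 n))
                        ≡ length (filter (λ A → + j ℤP.<? lch A) (𝓑 n))
lch-level-split n j = length-filter-⊎ _ _ _ split (λ eq → subst (+ j <ℤ_) (sym eq) j<suc-j)
  (ℤP.<-trans j<suc-j) (λ eq q → ℤP.<-irrefl (sym eq) q) (𝓑 n)
  where
  j<suc-j : + j <ℤ + suc j
  j<suc-j = ℤ.+<+ (ℕP.n<1+n j)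
  split : ∀ {x} → + j <ℤ x → x ≡ + suc j ⊎ + suc j <ℤ x
  split {x} j<x with x ℤP.≟ + suc j
  ... | yes eq = inj₁ eq
  ... | no ≢   = inj₂ (ℤP.≤∧≢⇒< (ℤP.i<j⇒suc[i]≤j j<x) (≢ ∘ sym))

lhs-level-split : ∀ n j → length (filter (λ A → lhs A ℕP.≟ suc j) (𝓑 n))
                        + length (filter (λ A → suc j ℕP.<? lhs A) (𝓑 n))
                        ≡ length (filter (λ A → j ℕP.<? lhs A) (𝓑 n))
lhs-level-split n j = length-filter-⊎ _ _ _ split (λ eq → subst (j <_) (sym eq) (ℕP.n<1+n j))
  (ℕP.<-trans (ℕP.n<1+n j)) (λ eq q → ℕP.<-irrefl (sym eq) q) (𝓑 n)
  where
  split : ∀ {x} → j < x → x ≡ suc j ⊎ suc j < x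
  split j<x with ℕP.m≤n⇒m<n∨m≡n j<x
  ... | inj₁ sj<x = inj₂ sj<x
  ... | inj₂ eq   = inj₁ (sym eq)

lch≡0-count : ∀ n → length (filter (λ A → lch A ℤP.≟ + 0) (𝓑 n)) ≡ 0
lch≡0-count n = cong length (ListP.filter-none _ (All.tabulate (λ A∈ eq →
  ¬Pos-0 (subst Pos eq (lch-Pos (proj₁ (∈-𝓑⁻ n A∈)))))))

lhs≡0-count : ∀ n → length (filter (λ A → lhs A ℕP.≟ 0) (𝓑 n)) ≡ 0
lhs≡0-count n = cong length (ListP.filter-none _ (All.tabulate (λ A∈ eq →
  ℕP.<-irrefl (sym eq) (lhs-Pos (proj₁ (∈-𝓑⁻ n A∈))))))

lch-lhs-equidistributed : ∀ n k → length (filter (λ A → lch A ℤP.≟ + k) (𝓑 n))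
                                ≡ length (filter (λ A → lhs A ℕP.≟ k) (𝓑 n))
lch-lhs-equidistributed n = point-counts-≡
  (λ k → length (filter (λ A → lch A ℤP.≟ + k) (𝓑 n))) (λ k → length (filter (λ A → lhs A ℕP.≟ k) (𝓑 n)))
  (λ j → length (filter (λ A → + j ℤP.<? lch A) (𝓑 n))) (λ j → length (filter (λ A → j ℕP.<? lhs A) (𝓑 n)))
  (trans (lch≡0-count n) (sym (lhs≡0-count n)))
  (λ j → trans (lch-tail-count n j) (sym (lhs-tail-count n j)))
  (lch-level-split n) (lhs-level-split n)

-- The tail counts hold for all n and h.
mainTheorem15 :
    ((n h : ℕ) → 2 ≤ n → h ≤ n ∸ 2 →
      (length (filter (λ A → + h ℤP.<? lch A) (𝓑 n)) ≡ length (𝓑 (n ∸ h)))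
      × (length (𝓑 (n ∸ h)) ≡ length (filter (λ A → h ℕP.<? lhs A) (𝓑 n))))
    × ((n k : ℕ) →
      length (filter (λ A → lch A ℤP.≟ + k) (𝓑 n))
        ≡ length (filter (λ A → lhs A ℕP.≟ k) (𝓑 n)))
mainTheorem15 = (λ n h _ _ → lch-tail-count n h , sym (lhs-tail-count n h)) , lch-lhs-equidistributed
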